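{- Let $T_1$ be the $2$-colored graph on vertex set $\{1,2,3,4\}$ with red edges $\{12,34,13,24\}$ and blue edges $\{12,34,14,23\}$. Then $ex(n,T_1)=\binom{n}{2}+\left\lfloor\frac{n^2}{4}\right\rfloor$ for every nonnegative integer $n\ne3$, and $ex(3,T_1)=6$. In particular $\pi(T_1)=\frac{3}{2}$.
   Context: A $2$-colored graph is $G=(V,E_r,E_b)$ with $E_r,E_b\subseteq\binom{V}{2}$ (not necessarily disjoint). $G$ is $H$-free if it contains no sub-graph isomorphic to $H$ (red edges into red, blue edges into blue). $ex(n,H)$ is the maximum of $|E_r(G)|+|E_b(G)|$ over $H$-free $2$-colored graphs $G$ on $n$ vertices, and $\pi(H)=\lim_{n\to\infty}ex(n,H)/\binom{n}{2}$. -}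

module Defs where

open import Data.Nat using (ℕ; zero; suc; _+_; _*_; _<ᵇ_)
open import Data.Nat.Combinatorics using (_C_)
open import Data.Bool using (Bool; true; false; T; _∧_; if_then_else_)
open import Data.Fin using (Fin; toℕ)
open import Data.List using (List; map; allFin)
open import Data.Nat.ListAction using (sum)
open import Data.Product using (Σ; _×_; ∃-syntax)
open import Data.Integer using (+_)
open import Data.Rational using (ℚ; _/_; _-_; ∣_∣; _<_; 0ℚ)
open import Function.Definitions using (Injective)
open import Relation.Binary.PropositionalEquality using (_≡_)

record TwoColored (n : ℕ) : Set where
  field
    red  : Fin n → Fin n → Bool
    blue : Fin n → Fin n → Bool
    red-sym   : ∀ i j → red i j ≡ red j i
    blue-sym  : ∀ i j → blue i j ≡ blue j i
    red-irr   : ∀ i → red i i ≡ false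
    blue-irr  : ∀ i → blue i i ≡ false
open TwoColored public

edgeCount : ∀ {n} → (Fin n → Fin n → Bool) → ℕ
edgeCount {n} r =
  sum (map (λ i → sum (map (λ j → if (toℕ i <ᵇ toℕ j) ∧ r i j then 1 else 0) (allFin n))) (allFin n))

size : ∀ {n} → TwoColored n → ℕ
size G = edgeCount (red G) + edgeCount (blue G)

Contains : ∀ {n m} → TwoColored n → TwoColored m → Set
Contains {n} {m} G H =
  Σ (Fin m → Fin n) λ φ →
    Injective _≡_ _≡_ φ
    × (∀ a b → T (red H a b) → T (red G (φ a) (φ b)))
    × (∀ a b → T (blue H a b) → T (blue G (φ a) (φ b)))

Free : ∀ {n m} → TwoColored n → TwoColored m → Set
Free G H = Contains G H → Data.Empty.⊥
  where import Data.Empty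

IsEx : ∀ {m} → TwoColored m → ℕ → ℕ → Set
IsEx H n e =
  (Σ (TwoColored n) λ G → Free G H × size G ≡ e)
  × (∀ (G : TwoColored n) → Free G H → size G Data.Nat.≤ e)
  where import Data.Nat

-- the rational a / b (with the convention a/0 = 0; only used for b = C(n,2), n ≥ 2)
frac : ℕ → ℕ → ℚ
frac a zero = 0ℚ
frac a (suc b) = (+ a) / suc b

ConvergesTo : (ℕ → ℚ) → ℚ → Set
ConvergesTo s L = ∀ (ε : ℚ) → 0ℚ < ε → ∃[ N ] (∀ n → N Data.Nat.≤ n → ∣ s n - L ∣ < ε)
  where import Data.Nat

-- T_1 on {0,1,2,3} (paper's vertices 1,2,3,4 shifted down by one)
-- red edges {01,23,02,13}, blue edges {01,23,03,12}
redT₁ℕ : ℕ → ℕ → Bool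
redT₁ℕ 0 1 = true
redT₁ℕ 1 0 = true
redT₁ℕ 2 3 = true
redT₁ℕ 3 2 = true
redT₁ℕ 0 2 = true
redT₁ℕ 2 0 = true
redT₁ℕ 1 3 = true
redT₁ℕ 3 1 = true
redT₁ℕ _ _ = false

blueT₁ℕ : ℕ → ℕ → Bool
blueT₁ℕ 0 1 = true
blueT₁ℕ 1 0 = true
blueT₁ℕ 2 3 = true
blueT₁ℕ 3 2 = true
blueT₁ℕ 0 3 = true
blueT₁ℕ 3 0 = true
blueT₁ℕ 1 2 = true
blueT₁ℕ 2 1 = true
blueT₁ℕ _ _ = false

T₁ : TwoColored 4
T₁ = record
  { red = λ i j → redT₁ℕ (toℕ i) (toℕ j)
  ; blue = λ i j → blueT₁ℕ (toℕ i) (toℕ j)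
  ; red-sym = rs
  ; blue-sym = bs
  ; red-irr = ri
  ; blue-irr = bi
  }
  where
  open import Data.Fin using (zero; suc)
  open import Relation.Binary.PropositionalEquality using (refl)
  rs : ∀ (i j : Fin 4) → redT₁ℕ (toℕ i) (toℕ j) ≡ redT₁ℕ (toℕ j) (toℕ i)
  rs zero zero = refl
  rs zero (suc zero) = refl
  rs zero (suc (suc zero)) = refl
  rs zero (suc (suc (suc zero))) = refl
  rs (suc zero) zero = refl
  rs (suc zero) (suc zero) = refl
  rs (suc zero) (suc (suc zero)) = refl
  rs (suc zero) (suc (suc (suc zero))) = refl
  rs (suc (suc zero)) zero = refl
  rs (suc (suc zero)) (suc zero) = refl
  rs (suc (suc zero)) (suc (suc zero)) = refl
  rs (suc (suc zero)) (suc (suc (suc zero))) = refl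
  rs (suc (suc (suc zero))) zero = refl
  rs (suc (suc (suc zero))) (suc zero) = refl
  rs (suc (suc (suc zero))) (suc (suc zero)) = refl
  rs (suc (suc (suc zero))) (suc (suc (suc zero))) = refl
  bs : ∀ (i j : Fin 4) → blueT₁ℕ (toℕ i) (toℕ j) ≡ blueT₁ℕ (toℕ j) (toℕ i)
  bs zero zero = refl
  bs zero (suc zero) = refl
  bs zero (suc (suc zero)) = refl
  bs zero (suc (suc (suc zero))) = refl
  bs (suc zero) zero = refl
  bs (suc zero) (suc zero) = refl
  bs (suc zero) (suc (suc zero)) = refl
  bs (suc zero) (suc (suc (suc zero))) = refl
  bs (suc (suc zero)) zero = refl
  bs (suc (suc zero)) (suc zero) = refl
  bs (suc (suc zero)) (suc (suc zero)) = refl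
  bs (suc (suc zero)) (suc (suc (suc zero))) = refl
  bs (suc (suc (suc zero))) zero = refl
  bs (suc (suc (suc zero))) (suc zero) = refl
  bs (suc (suc (suc zero))) (suc (suc zero)) = refl
  bs (suc (suc (suc zero))) (suc (suc (suc zero))) = refl
  ri : ∀ (i : Fin 4) → redT₁ℕ (toℕ i) (toℕ i) ≡ false
  ri zero = refl
  ri (suc zero) = refl
  ri (suc (suc zero)) = refl
  ri (suc (suc (suc zero))) = refl
  bi : ∀ (i : Fin 4) → blueT₁ℕ (toℕ i) (toℕ i) ≡ false
  bi zero = refl
  bi (suc zero) = refl
  bi (suc (suc zero)) = refl
  bi (suc (suc (suc zero))) = refl

{-# OPTIONS --safe #-}
module Submission where

-- Let w(i,j) ∈ {0,1,2} count the colours on the pair ij, so that twice the size of G is the sum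
-- of w over ordered pairs. If x, y, z are pairwise joined in both colours and G is T₁-free, a
-- vertex doubly joined to two of them is not joined to the third at all, so every other vertex
-- sends weight at most 4 to xyz; deleting xyz gives 2e(n) ≤ 2e(n-3) + 8(n-3) + 12. Without such
-- a triangle, deleting a doubly joined pair gives 2e(n) ≤ 2e(n-2) + 6(n-2) + 4, and without any
-- doubly joined pair every weight is at most 1. These recursions stay below
-- 2(C(n,2) + ⌊n²/4⌋), except at n = 3, where the doubled triangle has 6 edges. Equality holds
-- for two near-equal classes with red pairs inside one, blue pairs inside the other and both
-- colours across. Since 2⌊n²/4⌋ = C(n,2) + k with k ≤ n, the density tends to 3/2.

open import Defs
open import Data.Nat using (ℕ; _+_; _*_; _/_)
open import Data.Nat.Combinatorics using (_C_)
open import Data.Product using (_×_)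
open import Data.Integer using (+_)
open import Relation.Binary.PropositionalEquality using (_≢_)
import Data.Rational

open import Data.Bool using (Bool; true; false; T; _∧_; _∨_; _xor_; not; if_then_else_)
open import Data.Bool.Properties using (T-≡; T-∨; T-∧; ∨-comm; ∧-zeroʳ)
open import Data.Empty using (⊥; ⊥-elim)
open import Data.Fin using (Fin; toℕ; fromℕ<; zero; suc)
open import Data.Fin.Patterns using (0F; 1F; 2F; 3F)
open import Data.Fin.Properties using (_≟_; any?; all?; toℕ-injective; toℕ-fromℕ<; toℕ<n; pigeonhole)
open import Data.Integer as ℤ using (-[1+_]; +<+)
import Data.Integer.Properties as ℤ
open import Data.List using (tabulate; map; allFin)
open import Data.List.Properties using (map-tabulate)
import Data.Nat
open import Data.Nat using (zero; suc; _≤_; _<_; _<ᵇ_; z≤n; s≤s)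
open import Data.Nat.Combinatorics using (nCk+nC[k+1]≡[n+1]C[k+1]; nC1≡n)
open import Data.Nat.Coprimality using (Coprime)
open import Data.Nat.DivMod using (+-distrib-/-∣ʳ; m*n/n≡m)
open import Data.Nat.Divisibility using (divides)
open import Data.Nat.ListAction using () renaming (sum to listSum)
open import Data.Nat.Properties hiding (_≟_)
open import Algebra.Properties.Semiring.Sum +-*-semiring
  using (sum; sum-cong-≗; sum-replicate-zero; ∑-distrib-+; ∑-comm; *-distribˡ-sum)
open import Data.Nat.Solver using (module +-*-Solver)
open +-*-Solver using (solve; _:+_; _:*_; _:=_; con)
open import Data.Product using (_,_; proj₁; proj₂; ∃)
open import Data.Rational as ℚ using (ℚ; mkℚ; *<*)
import Data.Rational.Properties as ℚ
import Data.Rational.Unnormalised as ℚᵘ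
import Data.Rational.Unnormalised.Properties as ℚᵘ
open import Data.Sum using (inj₁; inj₂)
open import Data.Unit using (tt)
open import Function using (const; _∘′_)
open import Function.Bundles using (Equivalence; mk⇔)
open import Function.Definitions using (Injective)
open import Relation.Binary.Definitions using (tri<; tri≈; tri>)
open import Relation.Binary.PropositionalEquality
open import Relation.Nullary using (Dec; does; yes; no; ¬_)
open import Relation.Nullary.Decidable using (_×-dec_; T?; toWitness; dec-true; dec-false; does-⇔)

private
  variable
    n : ℕ

-- Sums over subsets of Fin n

bit : Bool → ℕ
bit b = if b then 1 else 0

sum-mono-≤ : {f g : Fin n → ℕ} → (∀ i → f i ≤ g i) → sum f ≤ sum g
sum-mono-≤ {zero}  f≤g = z≤n
sum-mono-≤ {suc n} f≤g = +-mono-≤ (f≤g zero) (sum-mono-≤ (λ i → f≤g (suc i)))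

listSum-tabulate : (f : Fin n → ℕ) → listSum (tabulate f) ≡ sum f
listSum-tabulate {zero}  f = refl
listSum-tabulate {suc n} f = cong (_+_ (f zero)) (listSum-tabulate (λ i → f (suc i)))

sum-δ : (a : Fin n) (x : ℕ) → sum (λ j → if does (j ≟ a) then x else 0) ≡ x
sum-δ {suc n} zero    x = trans (cong (_+_ x) (sum-replicate-zero n)) (+-identityʳ x)
sum-δ {suc n} (suc a) x = sum-δ a x

Subset : ℕ → Set
Subset n = Fin n → Bool

infixl 6 _─_
_─_ : Subset n → Fin n → Subset n
(S ─ a) j = S j ∧ not (does (j ≟ a))

restrict : Subset n → (Fin n → ℕ) → Fin n → ℕ
restrict S g j = if S j then g j else 0

∑∈ : Subset n → (Fin n → ℕ) → ℕ
∑∈ S g = sum (restrict S g)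

syntax ∑∈ S (λ j → g) = ∑[ j ∈ S ] g

card : Subset n → ℕ
card S = ∑[ j ∈ S ] 1

module _ (S : Subset n) where

  ∑∈-cong : {f g : Fin n → ℕ} → (∀ j → S j ≡ true → f j ≡ g j) → ∑∈ S f ≡ ∑∈ S g
  ∑∈-cong {f} {g} f≡g = sum-cong-≗ pointwise
    where
    pointwise : ∀ j → restrict S f j ≡ restrict S g j
    pointwise j with S j in Sj
    ... | true  = f≡g j Sj
    ... | false = refl

  ∑∈-mono-≤ : {f g : Fin n → ℕ} → (∀ j → S j ≡ true → f j ≤ g j) → ∑∈ S f ≤ ∑∈ S g
  ∑∈-mono-≤ {f} {g} f≤g = sum-mono-≤ pointwise
    where
    pointwise : ∀ j → restrict S f j ≤ restrict S g j
    pointwise j with S j in Sj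
    ... | true  = f≤g j Sj
    ... | false = z≤n

  ∑∈-distrib-+ : (f g : Fin n → ℕ) → ∑[ j ∈ S ] (f j + g j) ≡ ∑∈ S f + ∑∈ S g
  ∑∈-distrib-+ f g = trans (sum-cong-≗ pointwise) (∑-distrib-+ (restrict S f) (restrict S g))
    where
    pointwise : ∀ j → restrict S (λ j → f j + g j) j ≡ restrict S f j + restrict S g j
    pointwise j with S j
    ... | true  = refl
    ... | false = refl

  ∑∈-const : ∀ c → ∑[ j ∈ S ] c ≡ c * card S
  ∑∈-const c = trans (sum-cong-≗ pointwise) (sym (*-distribˡ-sum c (restrict S (const 1))))
    where
    pointwise : ∀ j → restrict S (const c) j ≡ c * restrict S (const 1) j
    pointwise j with S j
    ... | true  = sym (*-identityʳ c)
    ... | false = sym (*-zeroʳ c)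

  ∑∈-remove : ∀ {a} (g : Fin n → ℕ) → S a ≡ true → ∑∈ S g ≡ ∑∈ (S ─ a) g + g a
  ∑∈-remove {a} g Sa = begin
    ∑∈ S g                                                        ≡⟨ sum-cong-≗ split ⟩
    sum (λ j → restrict (S ─ a) g j + δ j)                        ≡⟨ ∑-distrib-+ (restrict (S ─ a) g) δ ⟩
    ∑∈ (S ─ a) g + sum δ                                          ≡⟨ cong (_+_ (∑∈ (S ─ a) g)) (sum-δ a (g a)) ⟩
    ∑∈ (S ─ a) g + g a                                            ∎
    where
    open ≡-Reasoning
    δ : Fin n → ℕ
    δ j = if does (j ≟ a) then g a else 0
    split : ∀ j → restrict S g j ≡ restrict (S ─ a) g j + δ j
    split j with j ≟ a
    split j | yes refl rewrite Sa = refl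
    split j | no _ with S j
    ... | true  = sym (+-identityʳ (g j))
    ... | false = refl

  card-remove : ∀ {a} → S a ≡ true → card S ≡ suc (card (S ─ a))
  card-remove Sa = trans (∑∈-remove (const 1) Sa) (+-comm _ 1)

  ∑∈-empty : (g : Fin n → ℕ) → (∀ j → S j ≡ false) → ∑∈ S g ≡ 0
  ∑∈-empty g empty = trans (sum-cong-≗ (λ j → cong (if_then g j else 0) (empty j))) (sum-replicate-zero n)

  card≡suc⇒member : ∀ {k} → card S ≡ suc k → ∃ λ a → S a ≡ true
  card≡suc⇒member card≡ with any? (λ a → S a Data.Bool.≟ true)
  ... | yes found = found
  ... | no none   = ⊥-elim (0≢1+n (trans (sym (∑∈-empty (const 1) absent)) card≡))
    where
    absent : ∀ j → S j ≡ false
    absent j with S j in Sj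
    ... | true  = ⊥-elim (none (j , Sj))
    ... | false = refl

card-─ : (S : Subset n) {a : Fin n} {m : ℕ} → S a ≡ true → card S ≡ suc m → card (S ─ a) ≡ m
card-─ S Sa card≡ = suc-injective (trans (sym (card-remove S Sa)) card≡)

card-full : card {n} (const true) ≡ n
card-full {zero}  = refl
card-full {suc n} = cong suc (card-full {n})

∑∈-≗ : {S T : Subset n} (g : Fin n → ℕ) → (∀ j → S j ≡ T j) → ∑∈ S g ≡ ∑∈ T g
∑∈-≗ g S≗T = sum-cong-≗ (λ j → cong (if_then g j else 0) (S≗T j))

─-⊆ : (S : Subset n) (a j : Fin n) → (S ─ a) j ≡ true → S j ≡ true
─-⊆ S a j with S j
... | true  = λ _ → refl
... | false = λ ()

─-keep : (S : Subset n) {a j : Fin n} → S j ≡ true → j ≢ a → (S ─ a) j ≡ true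
─-keep S {a} {j} Sj j≢a with j ≟ a
... | yes j≡a = ⊥-elim (j≢a j≡a)
... | no _    rewrite Sj = refl

[1+n]C2≡n+nC2 : ∀ n → suc n C 2 ≡ n + n C 2
[1+n]C2≡n+nC2 n = trans (sym (nCk+nC[k+1]≡[n+1]C[k+1] n 1)) (cong (_+ n C 2) (nC1≡n n))

module PairSum {n : ℕ} (w : Fin n → Fin n → ℕ)
               (w-sym : ∀ i j → w i j ≡ w j i) (w-diag : ∀ i → w i i ≡ 0) where

  degree : Subset n → Fin n → ℕ
  degree S a = ∑[ j ∈ S ] w a j

  pairSum : Subset n → ℕ
  pairSum S = ∑[ i ∈ S ] degree S i

  pairSum-≗ : {S T : Subset n} → (∀ j → S j ≡ T j) → pairSum S ≡ pairSum T
  pairSum-≗ {S} {T} S≗T = begin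
    ∑[ i ∈ S ] degree S i  ≡⟨ ∑∈-cong S (λ i _ → ∑∈-≗ (w i) S≗T) ⟩
    ∑[ i ∈ S ] degree T i  ≡⟨ ∑∈-≗ (degree T) S≗T ⟩
    ∑[ i ∈ T ] degree T i  ∎
    where open ≡-Reasoning

  pairSum-remove : ∀ S {a} → S a ≡ true → pairSum S ≡ pairSum (S ─ a) + 2 * degree (S ─ a) a
  pairSum-remove S {a} Sa = begin
    ∑[ i ∈ S ] degree S i
      ≡⟨ ∑∈-cong S (λ i _ → ∑∈-remove S (w i) Sa) ⟩
    ∑[ i ∈ S ] (degree S′ i + w i a)
      ≡⟨ ∑∈-distrib-+ S (degree S′) (λ i → w i a) ⟩
    ∑[ i ∈ S ] degree S′ i + ∑[ i ∈ S ] w i a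
      ≡⟨ cong₂ _+_ (∑∈-remove S (degree S′) Sa) (∑∈-remove S (λ i → w i a) Sa) ⟩
    (pairSum S′ + degree S′ a) + (∑[ i ∈ S′ ] w i a + w a a)
      ≡⟨ cong₂ (λ x y → (pairSum S′ + degree S′ a) + (x + y)) (∑∈-cong S′ (λ i _ → w-sym i a)) (w-diag a) ⟩
    (pairSum S′ + degree S′ a) + (degree S′ a + 0)
      ≡⟨ solve 2 (λ p d → (p :+ d) :+ (d :+ con 0) := p :+ con 2 :* d) refl (pairSum S′) (degree S′ a) ⟩
    pairSum S′ + 2 * degree S′ a
      ∎
    where
    open ≡-Reasoning
    S′ = S ─ a

  pairSum-remove₂ : ∀ S {a b} → S a ≡ true → (S ─ a) b ≡ true →
    pairSum S ≡ pairSum (S ─ a ─ b) + 2 * ∑[ v ∈ S ─ a ─ b ] (w a v + w b v) + 2 * w a b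
  pairSum-remove₂ S {a} {b} Sa Sb = begin
    pairSum S
      ≡⟨ pairSum-remove S Sa ⟩
    pairSum (S ─ a) + 2 * degree (S ─ a) a
      ≡⟨ cong₂ (λ x y → x + 2 * y) (pairSum-remove (S ─ a) Sb) (∑∈-remove (S ─ a) (w a) Sb) ⟩
    pairSum S″ + 2 * degree S″ b + 2 * (degree S″ a + w a b)
      ≡⟨ solve 4 (λ p db da e → p :+ con 2 :* db :+ con 2 :* (da :+ e) := p :+ con 2 :* (da :+ db) :+ con 2 :* e)
               refl (pairSum S″) (degree S″ b) (degree S″ a) (w a b) ⟩
    pairSum S″ + 2 * (degree S″ a + degree S″ b) + 2 * w a b
      ≡⟨ cong (λ x → pairSum S″ + 2 * x + 2 * w a b) (sym (∑∈-distrib-+ S″ (w a) (w b))) ⟩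
    pairSum S″ + 2 * ∑[ v ∈ S″ ] (w a v + w b v) + 2 * w a b
      ∎
    where
    open ≡-Reasoning
    S″ = S ─ a ─ b

  pairSum-remove₃ : ∀ S {a b u} → S a ≡ true → (S ─ a) b ≡ true → (S ─ a ─ b) u ≡ true →
    pairSum S ≡ pairSum (S ─ a ─ b ─ u) + 2 * ∑[ v ∈ S ─ a ─ b ─ u ] (w a v + w b v + w u v)
                                        + 2 * (w a b + w a u + w b u)
  pairSum-remove₃ S {a} {b} {u} Sa Sb Su = begin
    pairSum S
      ≡⟨ pairSum-remove₂ S Sa Sb ⟩
    pairSum (S ─ a ─ b) + 2 * ∑[ v ∈ S ─ a ─ b ] (w a v + w b v) + 2 * w a b
      ≡⟨ cong₂ (λ x y → x + 2 * y + 2 * w a b) (pairSum-remove (S ─ a ─ b) Su) (∑∈-remove (S ─ a ─ b) (λ v → w a v + w b v) Su) ⟩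
    pairSum S‴ + 2 * degree S‴ u + 2 * (∑[ v ∈ S‴ ] (w a v + w b v) + (w a u + w b u)) + 2 * w a b
      ≡⟨ solve 6 (λ p du dab au bu ab →
                    p :+ con 2 :* du :+ con 2 :* (dab :+ (au :+ bu)) :+ con 2 :* ab
                 := p :+ con 2 :* (dab :+ du) :+ con 2 :* (ab :+ au :+ bu))
               refl (pairSum S‴) (degree S‴ u) (∑[ v ∈ S‴ ] (w a v + w b v)) (w a u) (w b u) (w a b) ⟩
    pairSum S‴ + 2 * (∑[ v ∈ S‴ ] (w a v + w b v) + degree S‴ u) + 2 * (w a b + w a u + w b u)
      ≡⟨ cong (λ x → pairSum S‴ + 2 * x + 2 * (w a b + w a u + w b u))
              (sym (∑∈-distrib-+ S‴ (λ v → w a v + w b v) (w u))) ⟩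
    pairSum S‴ + 2 * ∑[ v ∈ S‴ ] (w a v + w b v + w u v) + 2 * (w a b + w a u + w b u)
      ∎
    where
    open ≡-Reasoning
    S‴ = S ─ a ─ b ─ u

  pairSum-≤-uniform : ∀ c m {S} → card S ≡ m → (∀ i j → S i ≡ true → S j ≡ true → w i j ≤ c) →
              pairSum S ≤ c * (2 * (m C 2))
  pairSum-≤-uniform c zero {S} card≡0 w≤c = ≤-reflexive (trans (∑∈-empty S (degree S) empty) (sym (*-zeroʳ c)))
    where
    empty : ∀ j → S j ≡ false
    empty j with S j in Sj
    ... | false = refl
    ... | true  = ⊥-elim (1+n≢0 (trans (sym (card-remove S Sj)) card≡0))
  pairSum-≤-uniform c (suc m) {S} card≡ w≤c with card≡suc⇒member S card≡
  ... | a , Sa = begin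
    pairSum S                                      ≡⟨ pairSum-remove S Sa ⟩
    pairSum (S ─ a) + 2 * degree (S ─ a) a         ≤⟨ +-mono-≤ (pairSum-≤-uniform c m card′ w≤c′) (*-monoʳ-≤ 2 degree≤) ⟩
    c * (2 * (m C 2)) + 2 * (c * m)                ≡⟨ solve 3 (λ c k m → c :* (con 2 :* k) :+ con 2 :* (c :* m)
                                                                  := c :* (con 2 :* (m :+ k))) refl c (m C 2) m ⟩
    c * (2 * (m + m C 2))                          ≡⟨ cong (λ x → c * (2 * x)) (sym ([1+n]C2≡n+nC2 m)) ⟩
    c * (2 * (suc m C 2))                          ∎
    where
    open ≤-Reasoning
    card′ : card (S ─ a) ≡ m
    card′ = card-─ S Sa card≡
    w≤c′ : ∀ i j → (S ─ a) i ≡ true → (S ─ a) j ≡ true → w i j ≤ c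
    w≤c′ i j Si Sj = w≤c i j (─-⊆ S a i Si) (─-⊆ S a j Sj)
    degree≤ : degree (S ─ a) a ≤ c * m
    degree≤ = begin
      degree (S ─ a) a       ≤⟨ ∑∈-mono-≤ (S ─ a) (λ j Sj → w≤c a j Sa (─-⊆ S a j Sj)) ⟩
      ∑[ j ∈ S ─ a ] c       ≡⟨ trans (∑∈-const (S ─ a) c) (cong (c *_) card′) ⟩
      c * m                  ∎

-- Edge counts as sums over ordered pairs

<ᵇ-true : ∀ {m k} → m < k → (m <ᵇ k) ≡ true
<ᵇ-true m<k = Equivalence.to T-≡ (<⇒<ᵇ m<k)

<ᵇ-false : ∀ {m k} → k ≤ m → (m <ᵇ k) ≡ false
<ᵇ-false {m} {k} k≤m with m <ᵇ k in m<ᵇk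
... | false = refl
... | true  = ⊥-elim (<⇒≱ (<ᵇ⇒< m k (Equivalence.from T-≡ m<ᵇk)) k≤m)

module _ (r : Fin n → Fin n → Bool) (r-sym : ∀ i j → r i j ≡ r j i) (r-irr : ∀ i → r i i ≡ false) where

  private
    forward : Fin n → Fin n → ℕ
    forward i j = bit ((toℕ i <ᵇ toℕ j) ∧ r i j)

    forward+backward : ∀ i j → forward i j + forward j i ≡ bit (r i j)
    forward+backward i j with <-cmp (toℕ i) (toℕ j)
    ... | tri< i<j _ _ rewrite <ᵇ-true i<j | <ᵇ-false (<⇒≤ i<j) = +-identityʳ _
    ... | tri> _ _ j<i rewrite <ᵇ-true j<i | <ᵇ-false (<⇒≤ j<i) | r-sym j i = refl
    ... | tri≈ _ i≡j _ rewrite toℕ-injective i≡j | r-irr j | <ᵇ-false (≤-refl {toℕ j}) = refl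

    listSum-map-allFin : (f : Fin n → ℕ) → listSum (map f (allFin n)) ≡ sum f
    listSum-map-allFin f = trans (cong listSum (map-tabulate (λ i → i) f)) (listSum-tabulate f)

    edgeCount≡∑forward : edgeCount r ≡ sum λ i → sum λ j → forward i j
    edgeCount≡∑forward = begin
      listSum (map row (allFin n))       ≡⟨ listSum-map-allFin row ⟩
      sum row                            ≡⟨ sum-cong-≗ (λ i → listSum-map-allFin (forward i)) ⟩
      (sum λ i → sum λ j → forward i j)  ∎
      where
      open ≡-Reasoning
      row : Fin n → ℕ
      row i = listSum (map (forward i) (allFin n))

  2*edgeCount≡∑∑ : 2 * edgeCount r ≡ sum λ i → sum λ j → bit (r i j)
  2*edgeCount≡∑∑ = begin
    2 * edgeCount r
      ≡⟨ cong (2 *_) edgeCount≡∑forward ⟩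
    2 * A
      ≡⟨ cong (_+_ A) (+-identityʳ A) ⟩
    A + A
      ≡⟨ cong (_+_ A) (∑-comm forward) ⟩
    A + (sum λ j → sum λ i → forward i j)
      ≡⟨ sym (∑-distrib-+ (λ i → sum (forward i)) (λ i → sum λ j → forward j i)) ⟩
    (sum λ i → sum (forward i) + sum λ j → forward j i)
      ≡⟨ sum-cong-≗ (λ i → trans (sym (∑-distrib-+ (forward i) (λ j → forward j i)))
                                 (sum-cong-≗ (forward+backward i))) ⟩
    (sum λ i → sum λ j → bit (r i j))
      ∎
    where
    open ≡-Reasoning
    A = sum λ i → sum λ j → forward i j

module Multiplicity (G : TwoColored n) where

  mult : Fin n → Fin n → ℕ
  mult i j = bit (red G i j) + bit (blue G i j)

  mult-sym : ∀ i j → mult i j ≡ mult j i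
  mult-sym i j = cong₂ _+_ (cong bit (red-sym G i j)) (cong bit (blue-sym G i j))

  mult-diag : ∀ i → mult i i ≡ 0
  mult-diag i rewrite red-irr G i | blue-irr G i = refl

  mult≤2 : ∀ i j → mult i j ≤ 2
  mult≤2 i j with red G i j | blue G i j
  ... | true  | true  = ≤-refl
  ... | true  | false = s≤s z≤n
  ... | false | true  = s≤s z≤n
  ... | false | false = z≤n

  Double : Fin n → Fin n → Set
  Double i j = T (red G i j) × T (blue G i j)

  Double? : ∀ i j → Dec (Double i j)
  Double? i j = T? (red G i j) ×-dec T? (blue G i j)

  red-flip : ∀ {i j} → T (red G i j) → T (red G j i)
  red-flip {i} {j} = subst T (red-sym G i j)

  blue-flip : ∀ {i j} → T (blue G i j) → T (blue G j i)
  blue-flip {i} {j} = subst T (blue-sym G i j)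

  Double-sym : ∀ {i j} → Double i j → Double j i
  Double-sym (r , b) = red-flip r , blue-flip b

  mult≡2⇒Double : ∀ i j → mult i j ≡ 2 → Double i j
  mult≡2⇒Double i j with red G i j | blue G i j
  ... | true  | true  = λ _ → tt , tt
  ... | true  | false = λ ()
  ... | false | true  = λ ()
  ... | false | false = λ ()

  ¬Double⇒mult≤1 : ∀ i j → ¬ Double i j → mult i j ≤ 1
  ¬Double⇒mult≤1 i j with red G i j | blue G i j
  ... | true  | true  = λ ¬double → ⊥-elim (¬double (tt , tt))
  ... | true  | false = λ _ → ≤-refl
  ... | false | true  = λ _ → ≤-refl
  ... | false | false = λ _ → z≤n

  Double⇒≢ : ∀ {i j} → Double i j → i ≢ j
  Double⇒≢ {i} (r , _) refl = subst T (red-irr G i) r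

  open PairSum mult mult-sym mult-diag public

  pairSum-≤-trivial : ∀ m {S} → card S ≡ m → pairSum S ≤ 2 * (2 * (m C 2))
  pairSum-≤-trivial m card≡ = pairSum-≤-uniform 2 m card≡ (λ i j _ _ → mult≤2 i j)

  2*size≡pairSum : 2 * size G ≡ pairSum (const true)
  2*size≡pairSum = begin
    2 * (edgeCount (red G) + edgeCount (blue G))
      ≡⟨ *-distribˡ-+ 2 (edgeCount (red G)) (edgeCount (blue G)) ⟩
    2 * edgeCount (red G) + 2 * edgeCount (blue G)
      ≡⟨ cong₂ _+_ (2*edgeCount≡∑∑ (red G) (red-sym G) (red-irr G))
                   (2*edgeCount≡∑∑ (blue G) (blue-sym G) (blue-irr G)) ⟩
    (sum λ i → sum λ j → bit (red G i j)) + (sum λ i → sum λ j → bit (blue G i j))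
      ≡⟨ sym (∑-distrib-+ (λ i → sum λ j → bit (red G i j)) (λ i → sum λ j → bit (blue G i j))) ⟩
    (sum λ i → (sum λ j → bit (red G i j)) + (sum λ j → bit (blue G i j)))
      ≡⟨ sum-cong-≗ (λ i → sym (∑-distrib-+ (λ j → bit (red G i j)) (λ j → bit (blue G i j)))) ⟩
    (sum λ i → sum λ j → mult i j)
      ∎
    where open ≡-Reasoning

-- Copies of T₁

T₁-complete : ∀ a b → T (does (a ≟ b) ∨ red T₁ a b ∨ blue T₁ a b)
T₁-complete = toWitness {a? = all? λ a → all? λ b → T? (does (a ≟ b) ∨ red T₁ a b ∨ blue T₁ a b)} tt

-- Two vertices with the same image are joined in H, which would give a loop in G.
preserving⇒injective : ∀ {m} {H : TwoColored m} (G : TwoColored n) (φ : Fin m → Fin n) →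
  (∀ a b → T (does (a ≟ b) ∨ red H a b ∨ blue H a b)) →
  (∀ a b → T (red H a b) → T (red G (φ a) (φ b))) →
  (∀ a b → T (blue H a b) → T (blue G (φ a) (φ b))) →
  Injective _≡_ _≡_ φ
preserving⇒injective {H = H} G φ joined φ-red φ-blue {a} {b} φa≡φb with a ≟ b | joined a b
... | yes a≡b | _ = a≡b
... | no _    | ab with Equivalence.to (T-∨ {red H a b}) ab
...   | inj₁ r = ⊥-elim (subst T (red-irr G (φ b)) (subst (λ x → T (red G x (φ b))) φa≡φb (φ-red a b r)))
...   | inj₂ β = ⊥-elim (subst T (blue-irr G (φ b)) (subst (λ x → T (blue G x (φ b))) φa≡φb (φ-blue a b β)))

sum≤3-unless-both-2 : ∀ {x y} → x ≤ 2 → y ≤ 2 → (x ≡ 2 → y ≡ 2 → ⊥) → x + y ≤ 3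
sum≤3-unless-both-2 z≤n             y≤2                     _   = m≤n⇒m≤1+n y≤2
sum≤3-unless-both-2 (s≤s z≤n)       y≤2                     _   = s≤s y≤2
sum≤3-unless-both-2 (s≤s (s≤s z≤n)) z≤n                     _   = s≤s (s≤s z≤n)
sum≤3-unless-both-2 (s≤s (s≤s z≤n)) (s≤s z≤n)               _   = ≤-refl
sum≤3-unless-both-2 (s≤s (s≤s z≤n)) (s≤s (s≤s z≤n))         2∧2 = ⊥-elim (2∧2 refl refl)

sum≤4-unless-two-are-2 : ∀ {x y z} → x ≤ 2 → y ≤ 2 → z ≤ 2 →
  (x ≡ 2 → y ≡ 2 → z ≡ 0) → (x ≡ 2 → z ≡ 2 → y ≡ 0) → (y ≡ 2 → z ≡ 2 → x ≡ 0) → x + y + z ≤ 4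
sum≤4-unless-two-are-2 z≤n y≤2 z≤2 _ _ _ = +-mono-≤ y≤2 z≤2
sum≤4-unless-two-are-2 (s≤s z≤n) y≤2 z≤2 _ _ yz⇒x =
  s≤s (sum≤3-unless-both-2 y≤2 z≤2 λ y≡2 z≡2 → 1+n≢0 (yz⇒x y≡2 z≡2))
sum≤4-unless-two-are-2 (s≤s (s≤s z≤n)) z≤n z≤2 _ _ _ = s≤s (s≤s z≤2)
sum≤4-unless-two-are-2 (s≤s (s≤s z≤n)) (s≤s z≤n) z≤n _ _ _ = n≤1+n 3
sum≤4-unless-two-are-2 (s≤s (s≤s z≤n)) (s≤s z≤n) (s≤s z≤n) _ _ _ = ≤-refl
sum≤4-unless-two-are-2 (s≤s (s≤s z≤n)) (s≤s z≤n) (s≤s (s≤s z≤n)) _ xz⇒y _ = ⊥-elim (1+n≢0 (xz⇒y refl refl))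
sum≤4-unless-two-are-2 (s≤s (s≤s z≤n)) (s≤s (s≤s z≤n)) _ xy⇒z _ _ rewrite xy⇒z refl refl = ≤-refl

module T₁Free (G : TwoColored n) (free : Free G T₁) where
  open Multiplicity G

  T₁-copy : ∀ p q r s → Double p q → Double r s → T (red G p r) → T (red G q s) →
            T (blue G p s) → T (blue G q r) → Contains G T₁
  T₁-copy p q r s (pq , pq′) (rs , rs′) pr qs ps′ qr′ =
    φ , preserving⇒injective {H = T₁} G φ T₁-complete φ-red φ-blue , φ-red , φ-blue
    where
    φ : Fin 4 → Fin n
    φ 0F = p
    φ 1F = q
    φ 2F = r
    φ 3F = s
    φ-red : ∀ a b → T (red T₁ a b) → T (red G (φ a) (φ b))
    φ-red 0F 1F _ = pq
    φ-red 1F 0F _ = red-flip pq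
    φ-red 2F 3F _ = rs
    φ-red 3F 2F _ = red-flip rs
    φ-red 0F 2F _ = pr
    φ-red 2F 0F _ = red-flip pr
    φ-red 1F 3F _ = qs
    φ-red 3F 1F _ = red-flip qs
    φ-red 0F 0F ()
    φ-red 0F 3F ()
    φ-red 1F 1F ()
    φ-red 1F 2F ()
    φ-red 2F 1F ()
    φ-red 2F 2F ()
    φ-red 3F 0F ()
    φ-red 3F 3F ()
    φ-blue : ∀ a b → T (blue T₁ a b) → T (blue G (φ a) (φ b))
    φ-blue 0F 1F _ = pq′
    φ-blue 1F 0F _ = blue-flip pq′
    φ-blue 2F 3F _ = rs′
    φ-blue 3F 2F _ = blue-flip rs′
    φ-blue 0F 3F _ = ps′
    φ-blue 3F 0F _ = blue-flip ps′
    φ-blue 1F 2F _ = qr′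
    φ-blue 2F 1F _ = blue-flip qr′
    φ-blue 0F 0F ()
    φ-blue 0F 2F ()
    φ-blue 1F 1F ()
    φ-blue 1F 3F ()
    φ-blue 2F 0F ()
    φ-blue 2F 2F ()
    φ-blue 3F 1F ()
    φ-blue 3F 3F ()

  -- A red (blue) pair zv would complete the copy v x z y (x z v y) of T₁.
  apex-unjoined : ∀ {x y z v} → Double x y → Double x z → Double y z → Double x v → Double y v → mult z v ≡ 0
  apex-unjoined {x} {y} {z} {v} xy@(xy-r , _) xz@(_ , xz-b) yz xv@(xv-r , _) yv@(_ , yv-b)
    with red G z v in zv-r | blue G z v in zv-b
  ... | false | false = refl
  ... | true  | _     = ⊥-elim (free (T₁-copy v x z y (Double-sym xv) (Double-sym yz)
                                                (red-flip (Equivalence.from T-≡ zv-r)) xy-r (blue-flip yv-b) xz-b))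
  ... | false | true  = ⊥-elim (free (T₁-copy x z v y xz (Double-sym yv) xv-r (red-flip (proj₁ yz))
                                                (proj₂ xy) (Equivalence.from T-≡ zv-b)))

-- The upper bound

twiceEx : ℕ → ℕ
twiceEx zero          = 0
twiceEx (suc zero)    = 0
twiceEx (suc (suc k)) = twiceEx k + (6 * k + 4)

-- ex(3, T₁) = 6 exceeds the general formula: the doubly coloured triangle contains no copy of T₁.
twiceEx′ : ℕ → ℕ
twiceEx′ 3 = 12
twiceEx′ m = twiceEx m

twiceEx′≡twiceEx : ∀ m → m ≢ 3 → twiceEx′ m ≡ twiceEx m
twiceEx′≡twiceEx 0                   _   = refl
twiceEx′≡twiceEx 1                   _   = refl
twiceEx′≡twiceEx 2                   _   = refl
twiceEx′≡twiceEx 3                   m≢3 = ⊥-elim (m≢3 refl)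
twiceEx′≡twiceEx (suc (suc (suc (suc k)))) _ = refl

[2+k]²/4≡k²/4+[1+k] : ∀ k → (suc (suc k) * suc (suc k)) / 4 ≡ k * k / 4 + suc k
[2+k]²/4≡k²/4+[1+k] k = begin
  (suc (suc k) * suc (suc k)) / 4  ≡⟨ cong (_/ 4) (solve 1 (λ k → (con 2 :+ k) :* (con 2 :+ k) := k :* k :+ (con 1 :+ k) :* con 4) refl k) ⟩
  (k * k + suc k * 4) / 4          ≡⟨ +-distrib-/-∣ʳ (k * k) (divides (suc k) refl) ⟩
  k * k / 4 + suc k * 4 / 4        ≡⟨ cong (_+_ (k * k / 4)) (m*n/n≡m (suc k) 4) ⟩
  k * k / 4 + suc k                ∎
  where open ≡-Reasoning

[2+k]C2≡[1+2k]+kC2 : ∀ k → suc (suc k) C 2 ≡ suc k + (k + k C 2)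
[2+k]C2≡[1+2k]+kC2 k = trans ([1+n]C2≡n+nC2 (suc k)) (cong (_+_ (suc k)) ([1+n]C2≡n+nC2 k))

twiceEx≡2[nC2+n²/4] : ∀ n → twiceEx n ≡ 2 * (n C 2 + n * n / 4)
twiceEx≡2[nC2+n²/4] zero          = refl
twiceEx≡2[nC2+n²/4] (suc zero)    = refl
twiceEx≡2[nC2+n²/4] (suc (suc k)) = begin
  twiceEx k + (6 * k + 4)
    ≡⟨ cong (_+ (6 * k + 4)) (twiceEx≡2[nC2+n²/4] k) ⟩
  2 * (k C 2 + k * k / 4) + (6 * k + 4)
    ≡⟨ solve 3 (λ c q k → con 2 :* (c :+ q) :+ (con 6 :* k :+ con 4)
                        := con 2 :* (((con 1 :+ k) :+ (k :+ c)) :+ (q :+ (con 1 :+ k)))) refl (k C 2) (k * k / 4) k ⟩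
  2 * ((suc k + (k + k C 2)) + (k * k / 4 + suc k))
    ≡⟨ cong₂ (λ c q → 2 * (c + q)) (sym ([2+k]C2≡[1+2k]+kC2 k)) (sym ([2+k]²/4≡k²/4+[1+k] k)) ⟩
  2 * (suc (suc k) C 2 + suc (suc k) * suc (suc k) / 4)
    ∎
  where open ≡-Reasoning

2*nC2≤twiceEx : ∀ n → 2 * (n C 2) ≤ twiceEx n
2*nC2≤twiceEx n = ≤-trans (*-monoʳ-≤ 2 (m≤m+n (n C 2) _)) (≤-reflexive (sym (twiceEx≡2[nC2+n²/4] n)))

twiceEx-gap : ∀ k → twiceEx (suc k) + (2 * k + 4) ≤ twiceEx (suc (suc k))
twiceEx-gap zero          = ≤-refl
twiceEx-gap (suc zero)    = ≤-refl
twiceEx-gap (suc (suc k)) = begin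
  twiceEx (suc k) + (6 * suc k + 4) + (2 * suc (suc k) + 4)
    ≡⟨ solve 2 (λ t k → t :+ (con 6 :* (con 1 :+ k) :+ con 4) :+ (con 2 :* (con 2 :+ k) :+ con 4)
                     := t :+ (con 2 :* k :+ con 4) :+ (con 6 :* k :+ con 14)) refl (twiceEx (suc k)) k ⟩
  twiceEx (suc k) + (2 * k + 4) + (6 * k + 14)
    ≤⟨ +-mono-≤ (twiceEx-gap k) (+-monoʳ-≤ (6 * k) (m≤m+n 14 2)) ⟩
  twiceEx (suc (suc k)) + (6 * k + 16)
    ≡⟨ cong (_+_ (twiceEx (suc (suc k)))) (solve 1 (λ k → con 6 :* k :+ con 16 := con 6 :* (con 2 :+ k) :+ con 4) refl k) ⟩
  twiceEx (suc (suc k)) + (6 * suc (suc k) + 4)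
    ∎
  where open ≤-Reasoning

twiceEx′-step₃ : ∀ k → twiceEx′ (suc k) + 2 * (4 * suc k) + 2 * 6 ≤ twiceEx (4 + k)
twiceEx′-step₃ k with k Data.Nat.≟ 2
... | yes refl = ≤-refl
... | no k≢2   = begin
  twiceEx′ (suc k) + 2 * (4 * suc k) + 2 * 6
    ≡⟨ cong (λ t → t + 2 * (4 * suc k) + 2 * 6) (twiceEx′≡twiceEx (suc k) (k≢2 ∘′ suc-injective)) ⟩
  twiceEx (suc k) + 2 * (4 * suc k) + 2 * 6
    ≡⟨ solve 2 (λ t k → t :+ con 2 :* (con 4 :* (con 1 :+ k)) :+ con 2 :* con 6
                     := t :+ (con 2 :* k :+ con 4) :+ (con 6 :* (con 2 :+ k) :+ con 4)) refl (twiceEx (suc k)) k ⟩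
  twiceEx (suc k) + (2 * k + 4) + (6 * suc (suc k) + 4)
    ≤⟨ +-monoˡ-≤ (6 * suc (suc k) + 4) (twiceEx-gap k) ⟩
  twiceEx (4 + k)
    ∎
  where open ≤-Reasoning

module UpperBound (G : TwoColored n) (free : Free G T₁) where
  open Multiplicity G
  open T₁Free G free

  DoubleEdgeIn : Subset n → Set
  DoubleEdgeIn S = ∃ λ a → ∃ λ b → S a ≡ true × S b ≡ true × Double a b

  DoubleTriangleIn : Subset n → Set
  DoubleTriangleIn S = ∃ λ a → ∃ λ b → ∃ λ u →
    S a ≡ true × S b ≡ true × S u ≡ true × Double a b × Double a u × Double b u

  doubleEdgeIn? : ∀ S → Dec (DoubleEdgeIn S)
  doubleEdgeIn? S = any? λ a → any? λ b →
    (S a Data.Bool.≟ true) ×-dec (S b Data.Bool.≟ true) ×-dec Double? a b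

  doubleTriangleIn? : ∀ S → Dec (DoubleTriangleIn S)
  doubleTriangleIn? S = any? λ a → any? λ b → any? λ u →
    (S a Data.Bool.≟ true) ×-dec (S b Data.Bool.≟ true) ×-dec (S u Data.Bool.≟ true) ×-dec
    Double? a b ×-dec Double? a u ×-dec Double? b u

  DoubleTriangleIn-mono : ∀ {S S′} → (∀ v → S′ v ≡ true → S v ≡ true) → DoubleTriangleIn S′ → DoubleTriangleIn S
  DoubleTriangleIn-mono S′⊆S (a , b , u , S′a , S′b , S′u , triangle) = a , b , u , S′⊆S a S′a , S′⊆S b S′b , S′⊆S u S′u , triangle

  pairSum≤twiceEx-triangleFree : ∀ m S → card S ≡ m → ¬ DoubleTriangleIn S → pairSum S ≤ twiceEx m
  pairSum≤twiceEx-triangleFree zero          S card≡ _ = pairSum-≤-trivial 0 card≡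
  pairSum≤twiceEx-triangleFree (suc zero)    S card≡ _ = pairSum-≤-trivial 1 card≡
  pairSum≤twiceEx-triangleFree (suc (suc k)) S card≡ noTriangle with doubleEdgeIn? S
  ... | no noEdge = begin
    pairSum S                        ≤⟨ pairSum-≤-uniform 1 _ card≡ simple ⟩
    1 * (2 * (suc (suc k) C 2))      ≡⟨ *-identityˡ _ ⟩
    2 * (suc (suc k) C 2)            ≤⟨ 2*nC2≤twiceEx (suc (suc k)) ⟩
    twiceEx (suc (suc k))            ∎
    where
    open ≤-Reasoning
    simple : ∀ i j → S i ≡ true → S j ≡ true → mult i j ≤ 1
    simple i j Si Sj = ¬Double⇒mult≤1 i j (λ ij → noEdge (i , j , Si , Sj , ij))
  ... | yes (a , b , Sa , Sb , ab) = begin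
    pairSum S
      ≡⟨ pairSum-remove₂ S Sa S′b ⟩
    pairSum S″ + 2 * ∑[ v ∈ S″ ] (mult a v + mult b v) + 2 * mult a b
      ≤⟨ +-mono-≤ (+-mono-≤ (pairSum≤twiceEx-triangleFree k S″ card″ noTriangle″) (*-monoʳ-≤ 2 fan≤))
                  (*-monoʳ-≤ 2 (mult≤2 a b)) ⟩
    twiceEx k + 2 * (3 * k) + 2 * 2
      ≡⟨ solve 2 (λ t k → t :+ con 2 :* (con 3 :* k) :+ con 2 :* con 2 := t :+ (con 6 :* k :+ con 4)) refl (twiceEx k) k ⟩
    twiceEx (suc (suc k))
      ∎
    where
    open ≤-Reasoning
    S″ = S ─ a ─ b
    S′b : (S ─ a) b ≡ true
    S′b = ─-keep S Sb (Double⇒≢ (Double-sym ab))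
    card″ : card S″ ≡ k
    card″ = card-─ (S ─ a) S′b (card-─ S Sa card≡)
    S″⊆S : ∀ v → S″ v ≡ true → S v ≡ true
    S″⊆S v S″v = ─-⊆ S a v (─-⊆ (S ─ a) b v S″v)
    noTriangle″ : ¬ DoubleTriangleIn S″
    noTriangle″ = noTriangle ∘′ DoubleTriangleIn-mono S″⊆S
    fan≤ : ∑[ v ∈ S″ ] (mult a v + mult b v) ≤ 3 * k
    fan≤ = begin
      ∑[ v ∈ S″ ] (mult a v + mult b v)  ≤⟨ ∑∈-mono-≤ S″ (λ v S″v → sum≤3-unless-both-2 (mult≤2 a v) (mult≤2 b v)
                                              λ av bv → noTriangle (a , b , v , Sa , Sb , S″⊆S v S″v , ab ,
                                                                    mult≡2⇒Double a v av , mult≡2⇒Double b v bv)) ⟩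
      ∑[ v ∈ S″ ] 3                      ≡⟨ trans (∑∈-const S″ 3) (cong (3 *_) card″) ⟩
      3 * k                              ∎

  pairSum≤twiceEx-doubleTriangle : ∀ k S → card S ≡ 4 + k → DoubleTriangleIn S →
    (∀ S′ → card S′ ≡ suc k → pairSum S′ ≤ twiceEx′ (suc k)) → pairSum S ≤ twiceEx (4 + k)
  pairSum≤twiceEx-doubleTriangle k S card≡ (a , b , u , Sa , Sb , Su , ab , au , bu) induction = begin
    pairSum S
      ≡⟨ pairSum-remove₃ S Sa S′b S″u ⟩
    pairSum S‴ + 2 * ∑[ v ∈ S‴ ] (mult a v + mult b v + mult u v) + 2 * (mult a b + mult a u + mult b u)
      ≤⟨ +-mono-≤ (+-mono-≤ (induction S‴ card‴) (*-monoʳ-≤ 2 fan≤))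
                  (*-monoʳ-≤ 2 (+-mono-≤ (+-mono-≤ (mult≤2 a b) (mult≤2 a u)) (mult≤2 b u))) ⟩
    twiceEx′ (suc k) + 2 * (4 * suc k) + 2 * 6
      ≤⟨ twiceEx′-step₃ k ⟩
    twiceEx (4 + k)
      ∎
    where
    open ≤-Reasoning
    S‴ = S ─ a ─ b ─ u
    S′b : (S ─ a) b ≡ true
    S′b = ─-keep S Sb (Double⇒≢ (Double-sym ab))
    S″u : (S ─ a ─ b) u ≡ true
    S″u = ─-keep (S ─ a) (─-keep S Su (Double⇒≢ (Double-sym au))) (Double⇒≢ (Double-sym bu))
    card‴ : card S‴ ≡ suc k
    card‴ = card-─ (S ─ a ─ b) S″u (card-─ (S ─ a) S′b (card-─ S Sa card≡))
    D : ∀ {x v} → mult x v ≡ 2 → Double x v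
    D {x} {v} = mult≡2⇒Double x v
    fan≤ : ∑[ v ∈ S‴ ] (mult a v + mult b v + mult u v) ≤ 4 * suc k
    fan≤ = begin
      ∑[ v ∈ S‴ ] (mult a v + mult b v + mult u v)
        ≤⟨ ∑∈-mono-≤ S‴ (λ v _ → sum≤4-unless-two-are-2 (mult≤2 a v) (mult≤2 b v) (mult≤2 u v)
             (λ av bv → apex-unjoined ab au bu (D av) (D bv))
             (λ av uv → apex-unjoined au ab (Double-sym bu) (D av) (D uv))
             (λ bv uv → apex-unjoined bu (Double-sym ab) (Double-sym au) (D bv) (D uv))) ⟩
      ∑[ v ∈ S‴ ] 4
        ≡⟨ trans (∑∈-const S‴ 4) (cong (4 *_) card‴) ⟩
      4 * suc k
        ∎

  pairSum≤twiceEx-large : ∀ k S → card S ≡ 4 + k →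
    (∀ S′ → card S′ ≡ suc k → pairSum S′ ≤ twiceEx′ (suc k)) → pairSum S ≤ twiceEx (4 + k)
  pairSum≤twiceEx-large k S card≡ induction with doubleTriangleIn? S
  ... | no noTriangle = pairSum≤twiceEx-triangleFree (4 + k) S card≡ noTriangle
  ... | yes triangle  = pairSum≤twiceEx-doubleTriangle k S card≡ triangle induction

  pairSum≤twiceEx′ : ∀ m S → card S ≡ m → pairSum S ≤ twiceEx′ m
  pairSum≤twiceEx′ 0 S card≡ = pairSum-≤-trivial 0 card≡
  pairSum≤twiceEx′ 1 S card≡ = pairSum-≤-trivial 1 card≡
  pairSum≤twiceEx′ 2 S card≡ = pairSum-≤-trivial 2 card≡
  pairSum≤twiceEx′ 3 S card≡ = pairSum-≤-trivial 3 card≡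
  pairSum≤twiceEx′ (suc (suc (suc (suc k)))) S card≡ = pairSum≤twiceEx-large k S card≡ (pairSum≤twiceEx′ (suc k))

  2*size≤twiceEx′ : 2 * size G ≤ twiceEx′ n
  2*size≤twiceEx′ = subst (_≤ twiceEx′ n) (sym 2*size≡pairSum) (pairSum≤twiceEx′ n (const true) card-full)

-- Extremal graphs

isEven : ℕ → Bool
isEven zero    = true
isEven (suc m) = not (isEven m)

private
  distinct : Fin n → Fin n → Bool
  distinct i j = not (does (i ≟ j))

  distinct-sym : (i j : Fin n) → distinct i j ≡ distinct j i
  distinct-sym i j = cong not (does-⇔ (mk⇔ sym sym) (i ≟ j) (j ≟ i))

  distinct-irr : (i : Fin n) → distinct i i ≡ false
  distinct-irr i = cong not (dec-true (i ≟ i) refl)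

  side : Fin n → Bool
  side i = isEven (toℕ i)

parityGraph : (n : ℕ) → TwoColored n
parityGraph n = record
  { red      = λ i j → distinct i j ∧ (side i ∨ side j)
  ; blue     = λ i j → distinct i j ∧ (not (side i) ∨ not (side j))
  ; red-sym  = λ i j → cong₂ _∧_ (distinct-sym i j) (∨-comm (side i) (side j))
  ; blue-sym = λ i j → cong₂ _∧_ (distinct-sym i j) (∨-comm (not (side i)) (not (side j)))
  ; red-irr  = λ i → cong (_∧ (side i ∨ side i)) (distinct-irr i)
  ; blue-irr = λ i → cong (_∧ (not (side i) ∨ not (side i))) (distinct-irr i)
  }

doubledTriangle : TwoColored 3
doubledTriangle = record
  { red = distinct ; blue = distinct
  ; red-sym = distinct-sym ; blue-sym = distinct-sym
  ; red-irr = distinct-irr ; blue-irr = distinct-irr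
  }

doubledTriangle-free : Free doubledTriangle T₁
doubledTriangle-free (φ , φ-injective , _) with pigeonhole (s≤s (s≤s (s≤s (s≤s z≤n)))) φ
... | i , j , i<j , φi≡φj = <-irrefl (cong toℕ (φ-injective φi≡φj)) i<j

private
  no-2-colouring : ∀ s₀ s₁ s₂ s₃ → T (s₀ ∨ s₁) → T (not s₀ ∨ not s₁) → T (s₂ ∨ s₃) → T (not s₂ ∨ not s₃) →
    T (s₀ ∨ s₂) → T (s₁ ∨ s₃) → T (not s₀ ∨ not s₃) → T (not s₁ ∨ not s₂) → ⊥
  no-2-colouring true  true  _     _     _  () _  _  _  _  _  _
  no-2-colouring false false _     _     () _  _  _  _  _  _  _
  no-2-colouring _     _     true  true  _  _  _  () _  _  _  _
  no-2-colouring _     _     false false _  _  () _  _  _  _  _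
  no-2-colouring true  false true  false _  _  _  _  _  () _  _
  no-2-colouring true  false false true  _  _  _  _  _  _  () _
  no-2-colouring false true  true  false _  _  _  _  _  _  _  ()
  no-2-colouring false true  false true  _  _  _  _  () _  _  _

-- The pairs 01 and 23 of T₁ are doubly coloured, so they must straddle the two sides;
-- the sides of 0 and 2 then violate one of the single-coloured pairs 02, 13, 03, 12.
parityGraph-free : ∀ n → Free (parityGraph n) T₁
parityGraph-free n (φ , _ , φ-red , φ-blue) =
  no-2-colouring (s 0F) (s 1F) (s 2F) (s 3F)
    (sides (φ-red 0F 1F tt)) (sides (φ-blue 0F 1F tt)) (sides (φ-red 2F 3F tt)) (sides (φ-blue 2F 3F tt))
    (sides (φ-red 0F 2F tt)) (sides (φ-red 1F 3F tt)) (sides (φ-blue 0F 3F tt)) (sides (φ-blue 1F 2F tt))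
  where
  s : Fin 4 → Bool
  s k = side (φ k)
  sides : ∀ {d b} → T (d ∧ b) → T b
  sides {d} = proj₂ ∘′ Equivalence.to (T-∧ {d})

below : ℕ → Subset n
below m j = toℕ j <ᵇ m

card-below : ∀ m → m ≤ n → card {n} (below m) ≡ m
card-below {n}     zero    _         = ∑∈-empty (below {n} 0) (const 1) (λ _ → refl)
card-below {suc n} (suc m) (s≤s m≤n) = cong suc (card-below m m≤n)

below-─ : ∀ {m} (a : Fin n) → toℕ a ≡ m → ∀ j → (below (suc m) ─ a) j ≡ below m j
below-─ {m = m} a a≡m j with <-cmp (toℕ j) m
... | tri< j<m _ _ rewrite <ᵇ-true (m<n⇒m<1+n j<m) | <ᵇ-true j<m
                         | dec-false (j ≟ a) (λ j≡a → <-irrefl (trans (cong toℕ j≡a) a≡m) j<m) = refl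
... | tri≈ _ j≡m _ rewrite toℕ-injective (trans j≡m (sym a≡m)) | dec-true (a ≟ a) refl
                         | ∧-zeroʳ (toℕ a <ᵇ suc m) | <ᵇ-false (≤-reflexive (sym a≡m)) = refl
... | tri> _ _ m<j rewrite <ᵇ-false {toℕ j} {suc m} m<j | <ᵇ-false {toℕ j} {m} (<⇒≤ m<j) = refl

module ParityGraph (n : ℕ) where
  open Multiplicity (parityGraph n)

  mult-parity : ∀ {i j} → i ≢ j → mult i j ≡ 1 + bit (side i xor side j)
  mult-parity {i} {j} i≢j rewrite dec-false (i ≟ j) i≢j with side i | side j
  ... | true  | true  = refl
  ... | true  | false = refl
  ... | false | true  = refl
  ... | false | false = refl

  pairSum-below : ∀ m → m ≤ n → pairSum (below m) ≡ twiceEx m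
  pairSum-below zero          _ = ∑∈-empty (below 0) (degree (below 0)) (λ _ → refl)
  pairSum-below (suc zero)    1≤n = n≤0⇒n≡0 (pairSum-≤-trivial 1 (card-below 1 1≤n))
  pairSum-below (suc (suc m)) m+2≤n = begin
    pairSum (below (2 + m))
      ≡⟨ pairSum-remove₂ (below (2 + m)) Sa S′b ⟩
    pairSum S″ + 2 * ∑[ v ∈ S″ ] (mult a v + mult b v) + 2 * mult a b
      ≡⟨ cong₂ (λ x y → x + 2 * y + 2 * mult a b) (pairSum-≗ S″≗below) (∑∈-≗ (λ v → mult a v + mult b v) S″≗below) ⟩
    pairSum (below m) + 2 * ∑[ v ∈ below m ] (mult a v + mult b v) + 2 * mult a b
      ≡⟨ cong₂ (λ x y → x + 2 * y + 2 * mult a b) (pairSum-below m m≤n) fan≡ ⟩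
    twiceEx m + 2 * (3 * m) + 2 * mult a b
      ≡⟨ cong (λ x → twiceEx m + 2 * (3 * m) + 2 * x) ab≡2 ⟩
    twiceEx m + 2 * (3 * m) + 2 * 2
      ≡⟨ solve 2 (λ t k → t :+ con 2 :* (con 3 :* k) :+ con 2 :* con 2 := t :+ (con 6 :* k :+ con 4)) refl (twiceEx m) m ⟩
    twiceEx (2 + m)
      ∎
    where
    open ≡-Reasoning
    m+1<n : suc m < n
    m+1<n = m+2≤n
    m<n : m < n
    m<n = <-trans (n<1+n m) m+1<n
    m≤n : m ≤ n
    m≤n = <⇒≤ m<n
    a b : Fin n
    a = fromℕ< m+1<n
    b = fromℕ< m<n
    a≡ : toℕ a ≡ suc m
    a≡ = toℕ-fromℕ< m+1<n
    b≡ : toℕ b ≡ m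
    b≡ = toℕ-fromℕ< m<n
    S″ = below (2 + m) ─ a ─ b
    Sa : below (2 + m) a ≡ true
    Sa = <ᵇ-true (≤-reflexive (cong suc a≡))
    S′b : (below (2 + m) ─ a) b ≡ true
    S′b = trans (below-─ a a≡ b) (<ᵇ-true (≤-reflexive (cong suc b≡)))
    S″≗below : ∀ j → S″ j ≡ below m j
    S″≗below j = trans (cong (_∧ not (does (j ≟ b))) (below-─ a a≡ j)) (below-─ b b≡ j)
    a≢b : a ≢ b
    a≢b a≡b = 1+n≢n (trans (sym a≡) (trans (cong toℕ a≡b) b≡))
    sides : side a ≡ not (side b)
    sides = trans (cong isEven a≡) (cong (not ∘′ isEven) (sym b≡))
    ab≡2 : mult a b ≡ 2
    ab≡2 rewrite mult-parity a≢b | sides with side b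
    ... | true  = refl
    ... | false = refl
    fan≡ : ∑[ v ∈ below m ] (mult a v + mult b v) ≡ 3 * m
    fan≡ = trans (∑∈-cong (below {n} m) three) (trans (∑∈-const (below {n} m) 3) (cong (3 *_) (card-below m m≤n)))
      where
      three : ∀ v → below m v ≡ true → mult a v + mult b v ≡ 3
      three v v<ᵇm = three′ v (<ᵇ⇒< (toℕ v) m (Equivalence.from T-≡ v<ᵇm))
        where
        three′ : ∀ v → toℕ v < m → mult a v + mult b v ≡ 3
        three′ v v<m rewrite mult-parity {a} {v} (λ a≡v → <-irrefl (trans (cong toℕ (sym a≡v)) a≡) (m<n⇒m<1+n v<m))
                           | mult-parity {b} {v} (λ b≡v → <-irrefl (trans (cong toℕ (sym b≡v)) b≡) v<m)
                           | sides with side b | side v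
        ... | true  | true  = refl
        ... | true  | false = refl
        ... | false | true  = refl
        ... | false | false = refl

  2*size≡twiceEx : 2 * size (parityGraph n) ≡ twiceEx n
  2*size≡twiceEx = begin
    2 * size (parityGraph n)  ≡⟨ 2*size≡pairSum ⟩
    pairSum (const true)      ≡⟨ pairSum-≗ (λ j → sym (<ᵇ-true (toℕ<n j))) ⟩
    pairSum (below n)         ≡⟨ pairSum-below n ≤-refl ⟩
    twiceEx n                 ∎
    where open ≡-Reasoning

-- The density

3/2 : ℚ
3/2 = + 3 ℚ./ 2

private
  2a-3[1+b]≡k : ∀ a b k → a * 2 ≡ k + 3 * suc b → (+ a) ℤ.* (+ 2) ℤ.+ -[1+ 2 ] ℤ.* (+ suc b) ≡ + k
  2a-3[1+b]≡k a b k eq = begin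
    (+ a) ℤ.* (+ 2) ℤ.+ -[1+ 2 ] ℤ.* (+ suc b)
      ≡⟨ cong (ℤ._+ (-[1+ 2 ] ℤ.* (+ suc b))) (trans (sym (ℤ.pos-* a 2)) (cong +_ eq)) ⟩
    + (k + 3 * suc b) ℤ.+ -[1+ 2 ] ℤ.* (+ suc b)
      ≡⟨ cong (ℤ._+ (-[1+ 2 ] ℤ.* (+ suc b))) (trans (ℤ.pos-+ k (3 * suc b)) (cong (λ z → (+ k) ℤ.+ z) (ℤ.pos-* 3 (suc b)))) ⟩
    (+ k) ℤ.+ (+ 3) ℤ.* (+ suc b) ℤ.+ -[1+ 2 ] ℤ.* (+ suc b)
      ≡⟨ ℤ.+-assoc (+ k) ((+ 3) ℤ.* (+ suc b)) (-[1+ 2 ] ℤ.* (+ suc b)) ⟩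
    (+ k) ℤ.+ ((+ 3) ℤ.* (+ suc b) ℤ.+ -[1+ 2 ] ℤ.* (+ suc b))
      ≡⟨ cong (λ z → (+ k) ℤ.+ z) (trans (sym (ℤ.*-distribʳ-+ (+ suc b) (+ 3) -[1+ 2 ])) (ℤ.*-zeroˡ (+ suc b))) ⟩
    (+ k) ℤ.+ (+ 0)
      ≡⟨ ℤ.+-identityʳ (+ k) ⟩
    + k
      ∎
    where open ≡-Reasoning

∣frac-3/2∣< : ∀ {a b k P D} .{c : Coprime (suc P) (suc D)} → a * 2 ≡ k + 3 * suc b →
  k * suc D < suc P * (suc b * 2) → ℚ.∣ frac a (suc b) ℚ.- 3/2 ∣ ℚ.< mkℚ (+ suc P) D c
∣frac-3/2∣< {a} {b} {k} {P} {D} a*2≡ k[1+D]< = ℚ.toℚᵘ-cancel-< (ℚᵘ.<-respˡ-≃ (ℚᵘ.≃-sym toℚᵘ-deviation) cross)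
  where
  x = frac a (suc b)
  toℚᵘ-deviation : ℚ.toℚᵘ ℚ.∣ x ℚ.- 3/2 ∣ ℚᵘ.≃ ℚᵘ.∣ ℚᵘ.mkℚᵘ (+ a) b ℚᵘ.+ ℚᵘ.mkℚᵘ -[1+ 2 ] 1 ∣
  toℚᵘ-deviation = ℚᵘ.≃-trans (ℚ.toℚᵘ-homo-∣-∣ (x ℚ.- 3/2))
    (ℚᵘ.∣-∣-cong (ℚᵘ.≃-trans (ℚ.toℚᵘ-homo-+ x (ℚ.- 3/2))
      (ℚᵘ.+-cong (ℚ.toℚᵘ-fromℚᵘ (ℚᵘ.mkℚᵘ (+ a) b)) (ℚ.toℚᵘ-homo‿- 3/2))))
  cross : ℚᵘ.∣ ℚᵘ.mkℚᵘ (+ a) b ℚᵘ.+ ℚᵘ.mkℚᵘ -[1+ 2 ] 1 ∣ ℚᵘ.< ℚᵘ.mkℚᵘ (+ suc P) D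
  cross = ℚᵘ.*<* (subst (λ z → (+ ℤ.∣ z ∣) ℤ.* (+ suc D) ℤ.< (+ suc P) ℤ.* (+ (suc b * 2)))
                        (sym (2a-3[1+b]≡k a b k a*2≡))
                        (subst₂ ℤ._<_ (ℤ.pos-* k (suc D)) (ℤ.pos-* (suc P) (suc b * 2)) (+<+ k[1+D]<)))

IsEx-unique : ∀ {m} {H : TwoColored m} {n a b} → IsEx H n a → IsEx H n b → a ≡ b
IsEx-unique ((G , G-free , size≡a) , ≤a) ((G′ , G′-free , size≡b) , ≤b) =
  ≤-antisym (subst (_≤ _) size≡a (≤b G G-free)) (subst (_≤ _) size≡b (≤a G′ G′-free))

2*[n²/4]≡nC2+excess : ∀ n → ∃ λ k → k ≤ n × 2 * (n * n / 4) ≡ n C 2 + k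
2*[n²/4]≡nC2+excess zero       = 0 , z≤n , refl
2*[n²/4]≡nC2+excess (suc zero) = 0 , z≤n , refl
2*[n²/4]≡nC2+excess (suc (suc m)) with 2*[n²/4]≡nC2+excess m
... | k , k≤m , eq = suc k , s≤s (m≤n⇒m≤1+n k≤m) , (begin
  2 * (suc (suc m) * suc (suc m) / 4)   ≡⟨ cong (2 *_) ([2+k]²/4≡k²/4+[1+k] m) ⟩
  2 * (m * m / 4 + suc m)               ≡⟨ *-distribˡ-+ 2 (m * m / 4) (suc m) ⟩
  2 * (m * m / 4) + 2 * suc m           ≡⟨ cong (_+ 2 * suc m) eq ⟩
  m C 2 + k + 2 * suc m                 ≡⟨ solve 3 (λ c k m → c :+ k :+ con 2 :* (con 1 :+ m)
                                                            := (con 1 :+ m) :+ (m :+ c) :+ (con 1 :+ k)) refl (m C 2) k m ⟩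
  suc m + (m + m C 2) + suc k           ≡⟨ cong (_+ suc k) (sym ([2+k]C2≡[1+2k]+kC2 m)) ⟩
  suc (suc m) C 2 + suc k               ∎)
  where open ≡-Reasoning

[1+m]*m≡2*[1+m]C2 : ∀ m → suc m * m ≡ 2 * (suc m C 2)
[1+m]*m≡2*[1+m]C2 zero    = refl
[1+m]*m≡2*[1+m]C2 (suc m) = begin
  suc (suc m) * suc m          ≡⟨ solve 1 (λ m → (con 2 :+ m) :* (con 1 :+ m) := con 2 :* (con 1 :+ m) :+ (con 1 :+ m) :* m) refl m ⟩
  2 * suc m + suc m * m        ≡⟨ cong (_+_ (2 * suc m)) ([1+m]*m≡2*[1+m]C2 m) ⟩
  2 * suc m + 2 * (suc m C 2)  ≡⟨ sym (*-distribˡ-+ 2 (suc m) (suc m C 2)) ⟩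
  2 * (suc m + suc m C 2)      ≡⟨ cong (2 *_) (sym ([1+n]C2≡n+nC2 (suc m))) ⟩
  2 * (suc (suc m) C 2)        ∎
  where open ≡-Reasoning

-- With N = C(n,2) = n(n-1)/2 and 2q = N + k, the deviation (N + q)/N - 3/2 is k/(2N) ≤ n/(n(n-1)).
ratio-deviation< : ∀ N q k n₀ {P D} .{c : Coprime (suc P) (suc D)} → 2 * q ≡ N + k → k ≤ suc n₀ →
  suc n₀ * n₀ ≡ 2 * N → suc D < n₀ → ℚ.∣ frac (N + q) N ℚ.- 3/2 ∣ ℚ.< mkℚ (+ suc P) D c
ratio-deviation< zero    q k (suc n₀) eq k≤n () D<n₀
ratio-deviation< (suc b) q k n₀ {P} {D} 2q≡ k≤n n·n₀≡ D<n₀ = ∣frac-3/2∣< {suc b + q} {b} {k} a*2≡ (begin-strict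
  k * suc D           ≤⟨ *-monoˡ-≤ (suc D) k≤n ⟩
  suc n₀ * suc D      <⟨ *-monoʳ-< (suc n₀) D<n₀ ⟩
  suc n₀ * n₀         ≡⟨ trans n·n₀≡ (*-comm 2 (suc b)) ⟩
  suc b * 2           ≤⟨ m≤m+n (suc b * 2) (P * (suc b * 2)) ⟩
  suc P * (suc b * 2) ∎)
  where
  open ≤-Reasoning
  a*2≡ : (suc b + q) * 2 ≡ k + 3 * suc b
  a*2≡ = begin-equality
    (suc b + q) * 2       ≡⟨ solve 2 (λ c q → (c :+ q) :* con 2 := con 2 :* c :+ con 2 :* q) refl (suc b) q ⟩
    2 * suc b + 2 * q     ≡⟨ cong (_+_ (2 * suc b)) 2q≡ ⟩
    2 * suc b + (suc b + k) ≡⟨ solve 2 (λ c k → con 2 :* c :+ (c :+ k) := k :+ con 3 :* c) refl (suc b) k ⟩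
    k + 3 * suc b         ∎

T₁-extremal : ∀ n → n ≢ 3 → IsEx T₁ n (n C 2 + n * n / 4)
T₁-extremal n n≢3 =
  (parityGraph n , parityGraph-free n , *-cancelˡ-≡ _ _ 2 (trans 2*size≡twiceEx (twiceEx≡2[nC2+n²/4] n))) ,
  λ G free → *-cancelˡ-≤ 2 (subst (2 * size G ≤_) twiceEx′≡2[nC2+n²/4] (2*size≤twiceEx′ G free))
  where
  open ParityGraph n using (2*size≡twiceEx)
  open UpperBound using (2*size≤twiceEx′)
  twiceEx′≡2[nC2+n²/4] : twiceEx′ n ≡ 2 * (n C 2 + n * n / 4)
  twiceEx′≡2[nC2+n²/4] = trans (twiceEx′≡twiceEx n n≢3) (twiceEx≡2[nC2+n²/4] n)

T₁-extremal₃ : IsEx T₁ 3 6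
T₁-extremal₃ = (doubledTriangle , doubledTriangle-free , refl) , λ G free → *-cancelˡ-≤ 2 (UpperBound.2*size≤twiceEx′ G free)

ex-ratio-deviation< : ∀ n₀ {P D} .{c : Coprime (suc P) (suc D)} → suc D < n₀ →
  ℚ.∣ frac (suc n₀ C 2 + suc n₀ * suc n₀ / 4) (suc n₀ C 2) ℚ.- 3/2 ∣ ℚ.< mkℚ (+ suc P) D c
ex-ratio-deviation< n₀ D<n₀ with 2*[n²/4]≡nC2+excess (suc n₀)
... | k , k≤n , 2q≡ = ratio-deviation< (suc n₀ C 2) (suc n₀ * suc n₀ / 4) k n₀ 2q≡ k≤n ([1+m]*m≡2*[1+m]C2 n₀) D<n₀

T₁-density : ∀ (f : ℕ → ℕ) → (∀ n → IsEx T₁ n (f n)) → ConvergesTo (λ n → frac (f n) (n C 2)) 3/2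
T₁-density f isEx (mkℚ (+ zero)   D c) (*<* (+<+ ()))
T₁-density f isEx (mkℚ -[1+ _ ]   D c) (*<* ())
T₁-density f isEx (mkℚ (+ suc P) D c) _ = 4 + D , tail
  where
  tail : ∀ n → 4 + D ≤ n → ℚ.∣ frac (f n) (n C 2) ℚ.- 3/2 ∣ ℚ.< mkℚ (+ suc P) D c
  tail n@(suc n₀@(suc (suc (suc m)))) (s≤s (s≤s (s≤s (s≤s D≤m)))) =
    subst (λ e → ℚ.∣ frac e (n C 2) ℚ.- 3/2 ∣ ℚ.< mkℚ (+ suc P) D c)
          (IsEx-unique {H = T₁} (T₁-extremal n (λ ())) (isEx n))
          (ex-ratio-deviation< n₀ {P} {D} (s≤s (s≤s (m≤n⇒m≤1+n D≤m))))

mainTheorem8 : (∀ (n : ℕ) → n ≢ 3 → IsEx T₁ n (n C 2 + (n * n) / 4))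
    × IsEx T₁ 3 6
    × (∀ (f : ℕ → ℕ) → (∀ n → IsEx T₁ n (f n)) →
         ConvergesTo (λ n → frac (f n) (n C 2)) ((+ 3) Data.Rational./ 2))
mainTheorem8 = T₁-extremal , T₁-extremal₃ , T₁-density
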